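{- Let $a \ge 2$ be even and $A = \{0,1,\dots,a-1\}$. Let $M = a^3/4$. For $i \in \{1,\dots,M\}$ define letters $x_i, y_i, z_i \in A$ as follows: (1) $\langle x_i\rangle$ is the sequence consisting of $a^2/2$ letters $0,1,0,1,\dots,0,1$, followed by $a^2/2$ letters $2,3,2,3,\dots,2,3$, and so on, ending with $a^2/2$ letters $a-2,a-1,\dots,a-2,a-1$; explicitly $x_i = 2\lfloor (i-1)/(a^2/2)\rfloor + ((i-1) \bmod 2)$. (2) $\langle y_i\rangle$ is the sequence of $a^2/2$ letters consisting of $a$ letters $0,1,\dots,0,1$, then $a$ letters $2,3,\dots,2,3$, and so on up to $a$ letters $a-2,a-1,\dots,a-2,a-1$, repeated $a/2$ times; explicitly $y_i = 2\lfloor ((i-1) \bmod (a^2/2))/a\rfloor + ((i-1)\bmod 2)$. (3) $\langle z_i\rangle$ is the sequence $1,0,3,2,5,4,\dots,a-1,a-2$ of length $a$ repeated $a^2/4$ times; explicitly, with $r = (i-1) \bmod a$, $z_i = r+1$ if $r$ is even and $z_i = r-1$ if $r$ is odd. Let $w_i$ be the three-letter word $x_iy_iz_i$, and let $$u = w_1\,\diamond\, w_2\,\diamond\,\cdots\,\diamond\, w_M\,\diamond\, w_1.$$ Then $u$ is a universal partial word for $A^4$.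
   Context: A partial word over $A$ is a finite sequence of characters from $A \cup \{\diamond\}$, where $\diamond \notin A$ is a wild-card symbol; a word over $A$ contains no $\diamond$. $A^n$ denotes the set of words of length $n$ over $A$. For $x = x_1\cdots x_n \in A^n$ and a partial word $w = w_1\cdots w_N$, the position $i$ ($0 \le i \le N-n$) covers $x$ if $x_j = w_{i+j}$ for every $1\le j\le n$ with $w_{i+j}\in A$. A universal partial word for $A^n$ is a partial word $w$ such that every word in $A^n$ is covered by exactly one position of $w$. -}

module Defs where

open import Data.Nat using (ℕ; zero; suc; _+_; _*_; _∸_; _^_; _≤_; _<_; NonZero; s≤s; z≤n; >-nonZero)
open import Data.Nat.DivMod using (_/_; _%_; m≥n⇒m/n>0)
open import Data.Fin using (Fin; toℕ)
open import Data.Vec using (Vec)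
import Data.Vec as Vec
open import Data.List using (List; []; _∷_; _++_; length; concatMap; map; upTo)
open import Data.List.Relation.Unary.All using (All)
open import Data.Maybe using (Maybe; just; nothing)
open import Data.Unit using (⊤)
open import Data.Product using (Σ; _×_; _,_; ∃; ∃-syntax)
open import Relation.Binary.PropositionalEquality using (_≡_)

-- Alphabet A = {0,1,…,a-1}, represented as Fin a (a letter c ∈ A is toℕ c).
-- A partial word is a list of entries: 'just c' is the letter c, 'nothing' is the hole ◇.
-- Letters are stored as natural numbers; a partial word over A additionally has every
-- letter < a (see IsOver).
PWord : Set
PWord = List (Maybe ℕ)

LetterIn : ℕ → Maybe ℕ → Set
LetterIn a nothing = ⊤
LetterIn a (just c) = c < a

IsOver : ℕ → PWord → Set
IsOver a w = All (LetterIn a) w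

-- Entry at 0-based position k (only used for k < length w)
_!_ : PWord → ℕ → Maybe ℕ
[] ! k = nothing
(c ∷ w) ! zero = c
(c ∷ w) ! suc k = w ! k

Compat : Maybe ℕ → ℕ → Set
Compat nothing l = ⊤
Compat (just c) l = l ≡ c

Covers : {a n : ℕ} → PWord → ℕ → Vec (Fin a) n → Set
Covers {a} {n} w i x =
  (i + n ≤ length w) × ((j : Fin n) → Compat (w ! (i + toℕ j)) (toℕ (Vec.lookup x j)))

Universal : (a n : ℕ) → PWord → Set
Universal a n w =
  IsOver a w ×
  ((x : Vec (Fin a) n) → ∃[ i ] (Covers w i x × ((k : ℕ) → Covers w k x → k ≡ i)))

≥2⇒nz : {a : ℕ} → 2 ≤ a → NonZero a
≥2⇒nz (s≤s _) = _

≥2⇒nz-half : {a : ℕ} → 2 ≤ a → NonZero ((a * a) / 2)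
≥2⇒nz-half {suc (suc m)} (s≤s (s≤s _)) =
  >-nonZero (m≥n⇒m/n>0 {suc (suc m) * suc (suc m)} {2} (s≤s (s≤s z≤n)))

-- The construction of Theorem 5.2, indexed 0-based: k = i - 1, k = 0 … M-1.
module Construction (a : ℕ) (a≥2 : 2 ≤ a) where
  private
    instance
      nzA : NonZero a
      nzA = ≥2⇒nz a≥2
      nzH : NonZero ((a * a) / 2)
      nzH = ≥2⇒nz-half a≥2

  M : ℕ
  M = (a ^ 3) / 4

  xₙ : ℕ → ℕ
  xₙ k = 2 * (k / ((a * a) / 2)) + (k % 2)

  yₙ : ℕ → ℕ
  yₙ k = 2 * ((k % ((a * a) / 2)) / a) + (k % 2)

  zₙ : ℕ → ℕ
  zₙ k with (k % a) % 2
  ... | zero = suc (k % a)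
  ... | suc _ = (k % a) ∸ 1

  wₙ : ℕ → PWord
  wₙ k = just (xₙ k) ∷ just (yₙ k) ∷ just (zₙ k) ∷ []

  u : PWord
  u = concatMap (λ k → wₙ k ++ (nothing ∷ [])) (upTo M) ++ wₙ 0

-- Write a = 2b and handle every letter and every block index through its half and its parity,
-- c = 2h + f.  A block index k < M = 2b³ is k = 2t + f with t < b³ written in base b as
-- (hi t, mid t, lo t), and then w_k = (2 hi t + f)(2 mid t + f)(2 lo t + 1 - f); the block after
-- w_k in u has index k + 1 mod M = 2((t + f) mod b³) + (1 - f).  Along u the parities therefore
-- repeat the pattern  f f f̄ ◇ f̄ f̄ f ◇,  whose length-4 windows have pairwise different parity
-- vectors however the hole is filled, so the parities of a word fix the offset of any window
-- covering it.  The halves of its three letters are three digits of t and of (t + f) mod b³,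
-- which determine k because t ↦ (t + f) mod n is a bijection of [0, n) for n = b, b², b³; the
-- same bijection yields, for every choice of parities and halves, a window that reads them.

module Submission where

open import Defs
open import Data.Nat using (ℕ; zero; suc; _+_; _*_; _∸_; _≤_; _<_; z≤n; s≤s; z<s; s<s; NonZero; _<?_)
open import Data.Nat.Properties
open import Data.Nat.DivMod
open import Data.Nat.Divisibility using (_∣_; divides)
open import Data.Nat.Tactic.RingSolver using (solve-∀)
open import Data.Fin using (Fin; zero; suc; toℕ; #_)
open import Data.Fin.Properties using (toℕ<n)
open import Data.Vec using (Vec; []; _∷_; lookup)
import Data.Vec as Vec
open import Data.Vec.Properties using (lookup-map)
open import Data.List using ([]; _∷_; _++_; length; concatMap; applyUpTo; upTo)
import Data.List as List
open import Data.List.Properties using (++-assoc; length-++; map-++)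
open import Data.List.Relation.Unary.All using (All; []; _∷_)
open import Data.List.Relation.Unary.All.Properties using (++⁺; concat⁺; map⁺; applyUpTo⁺₁)
open import Data.Maybe using (Maybe; just; nothing)
import Data.Maybe as Maybe
open import Data.Unit using (tt)
open import Data.Product using (_×_; _,_; proj₁; proj₂; ∃-syntax)
open import Data.Sum using (_⊎_; inj₁; inj₂)
open import Data.Empty using (⊥-elim)
open import Function using (_∘′_)
open import Relation.Nullary using (Dec; yes; no)
open import Relation.Binary.PropositionalEquality
open ≡-Reasoning

-- Adding a constant modulo n

[r+q*n]%n≡r : ∀ {r} q {n} .{{_ : NonZero n}} → r < n → (r + q * n) % n ≡ r
[r+q*n]%n≡r {r} q {n} r<n = trans ([m+kn]%n≡m%n r q n) (m<n⇒m%n≡m r<n)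

[r+q*n]/n≡q : ∀ {r} q {n} .{{_ : NonZero n}} → r < n → (r + q * n) / n ≡ q
[r+q*n]/n≡q {r} q {n} r<n = begin
  (r + q * n) / n     ≡⟨ +-distrib-/-∣ʳ r (divides q refl) ⟩
  r / n + q * n / n   ≡⟨ cong₂ _+_ (m<n⇒m/n≡0 r<n) (m*n/n≡m q n) ⟩
  q                   ∎

[m%d+f]%d≡[m+f]%d : ∀ m f d .{{_ : NonZero d}} → (m % d + f) % d ≡ (m + f) % d
[m%d+f]%d≡[m+f]%d m f d = begin
  (m % d + f) % d                ≡⟨ [m+kn]%n≡m%n (m % d + f) (m / d) d ⟨
  (m % d + f + m / d * d) % d    ≡⟨ cong (_% d) (+-assoc (m % d) f (m / d * d)) ⟩
  (m % d + (f + m / d * d)) % d  ≡⟨ cong (λ x → (m % d + x) % d) (+-comm f (m / d * d)) ⟩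
  (m % d + (m / d * d + f)) % d  ≡⟨ cong (_% d) (+-assoc (m % d) (m / d * d) f) ⟨
  (m % d + m / d * d + f) % d    ≡⟨ cong (λ x → (x + f) % d) (m≡m%n+[m/n]*n m d) ⟨
  (m + f) % d                    ∎

%-shift : ∀ {d n} m f .{{_ : NonZero d}} .{{_ : NonZero n}} → d ∣ n →
          (m + f) % n % d ≡ (m % d + f) % d
%-shift {d} {n} m f d∣n =
  trans (m∣n⇒o%n%m≡o%m d n (m + f) d∣n) (sym ([m%d+f]%d≡[m+f]%d m f d))

suc-%-injective : ∀ {n x y} .{{_ : NonZero n}} → x < n → y < n → suc x % n ≡ suc y % n → x ≡ y
suc-%-injective {n} {x} {y} x<n y<n eq
  with m≤n⇒m<n∨m≡n x<n | m≤n⇒m<n∨m≡n y<n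
... | inj₁ 1+x<n | inj₁ 1+y<n =
  suc-injective (trans (sym (m<n⇒m%n≡m 1+x<n)) (trans eq (m<n⇒m%n≡m 1+y<n)))
... | inj₂ 1+x≡n | inj₂ 1+y≡n = suc-injective (trans 1+x≡n (sym 1+y≡n))
... | inj₁ 1+x<n | inj₂ refl = ⊥-elim (1+n≢0 (trans (sym (m<n⇒m%n≡m 1+x<n)) (trans eq (n%n≡0 n))))
... | inj₂ refl | inj₁ 1+y<n = ⊥-elim (1+n≢0 (trans (sym (m<n⇒m%n≡m 1+y<n)) (trans (sym eq) (n%n≡0 n))))

suc-%-surjective : ∀ {n y} .{{_ : NonZero n}} → y < n → ∃[ x ] x < n × suc x % n ≡ y
suc-%-surjective {suc n} {zero} _ = n , ≤-refl , n%n≡0 (suc n)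
suc-%-surjective {n} {suc y} 1+y<n = y , <-trans ≤-refl 1+y<n , m<n⇒m%n≡m 1+y<n

suc[m%n]%n≡suc[m]%n : ∀ m n .{{_ : NonZero n}} → suc (m % n) % n ≡ suc m % n
suc[m%n]%n≡suc[m]%n m n = begin
  suc (m % n) % n   ≡⟨ cong (_% n) (+-comm (m % n) 1) ⟨
  (m % n + 1) % n   ≡⟨ [m%d+f]%d≡[m+f]%d m 1 n ⟩
  (m + 1) % n       ≡⟨ cong (_% n) (+-comm m 1) ⟩
  suc m % n         ∎

+-%-injective : ∀ {n x y} f .{{_ : NonZero n}} → x < n → y < n →
                (x + f) % n ≡ (y + f) % n → x ≡ y
+-%-injective {n} {x} {y} zero x<n y<n eq = begin
  x             ≡⟨ m<n⇒m%n≡m x<n ⟨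
  x % n         ≡⟨ cong (_% n) (+-identityʳ x) ⟨
  (x + 0) % n   ≡⟨ eq ⟩
  (y + 0) % n   ≡⟨ cong (_% n) (+-identityʳ y) ⟩
  y % n         ≡⟨ m<n⇒m%n≡m y<n ⟩
  y             ∎
+-%-injective {n} {x} {y} (suc f) x<n y<n eq =
  +-%-injective f x<n y<n (suc-%-injective (m%n<n (x + f) n) (m%n<n (y + f) n) (begin
    suc ((x + f) % n) % n   ≡⟨ suc[m%n]%n≡suc[m]%n (x + f) n ⟩
    suc (x + f) % n         ≡⟨ cong (_% n) (+-suc x f) ⟨
    (x + suc f) % n         ≡⟨ eq ⟩
    (y + suc f) % n         ≡⟨ cong (_% n) (+-suc y f) ⟩
    suc (y + f) % n         ≡⟨ suc[m%n]%n≡suc[m]%n (y + f) n ⟨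
    suc ((y + f) % n) % n   ∎))

+-%-surjective : ∀ {n y} f .{{_ : NonZero n}} → y < n → ∃[ x ] x < n × (x + f) % n ≡ y
+-%-surjective {n} {y} zero y<n =
  y , y<n , trans (cong (_% n) (+-identityʳ y)) (m<n⇒m%n≡m y<n)
+-%-surjective {n} {y} (suc f) y<n with suc-%-surjective y<n
... | z , z<n , 1+z≡y with +-%-surjective f z<n
...   | x , x<n , x+f≡z = x , x<n , (begin
  (x + suc f) % n         ≡⟨ cong (_% n) (+-suc x f) ⟩
  suc (x + f) % n         ≡⟨ suc[m%n]%n≡suc[m]%n (x + f) n ⟨
  suc ((x + f) % n) % n   ≡⟨ cong (λ w → suc w % n) x+f≡z ⟩
  suc z % n               ≡⟨ 1+z≡y ⟩
  y                       ∎)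

-- Letters as half and parity

pack : ℕ → ℕ → ℕ
pack h f = 2 * h + f

pack≡f+h*2 : ∀ h f → pack h f ≡ f + h * 2
pack≡f+h*2 h f = trans (+-comm (2 * h) f) (cong (f +_) (*-comm 2 h))

pack-/2 : ∀ h {f} → f < 2 → pack h f / 2 ≡ h
pack-/2 h {f} f<2 = trans (/-congˡ (pack≡f+h*2 h f)) ([r+q*n]/n≡q h f<2)

pack-%2 : ∀ h {f} → f < 2 → pack h f % 2 ≡ f
pack-%2 h {f} f<2 = trans (%-congˡ (pack≡f+h*2 h f)) ([r+q*n]%n≡r h f<2)

pack-injective : ∀ {h h′ f f′} → f < 2 → f′ < 2 → pack h f ≡ pack h′ f′ → h ≡ h′ × f ≡ f′
pack-injective {h} {h′} {f} {f′} f<2 f′<2 eq =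
  trans (sym (pack-/2 h f<2)) (trans (cong (_/ 2) eq) (pack-/2 h′ f′<2)) ,
  trans (sym (pack-%2 h f<2)) (trans (cong (_% 2) eq) (pack-%2 h′ f′<2))

pack-/2-%2 : ∀ m → pack (m / 2) (m % 2) ≡ m
pack-/2-%2 m = trans (pack≡f+h*2 (m / 2) (m % 2)) (sym (m≡m%n+[m/n]*n m 2))

pack-< : ∀ {h f n} → h < n → f < 2 → pack h f < n * 2
pack-< {h} {f} {n} h<n f<2 =
  <-≤-trans (+-monoʳ-< (2 * h) f<2) (≤-trans (≤-reflexive (lemma h)) (*-monoˡ-≤ 2 h<n))
  where
  lemma : ∀ h → 2 * h + 2 ≡ suc h * 2
  lemma = solve-∀

pack-% : ∀ h {f n} .{{_ : NonZero n}} .{{_ : NonZero (n * 2)}} → f < 2 →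
         pack h f % (n * 2) ≡ pack (h % n) f
pack-% h {f} {n} f<2 = begin
  (2 * h + f) % (n * 2)        ≡⟨ cong (λ x → (x + f) % (n * 2)) (*-comm 2 h) ⟩
  (h * 2 + f) % (n * 2)        ≡⟨ [m*n+o]%[p*n]≡[m*n]%[p*n]+o h n f<2 ⟩
  h * 2 % (n * 2) + f          ≡⟨ cong (_+ f) (m%n*o≡m*o%[n*o] h n 2) ⟨
  h % n * 2 + f                ≡⟨ cong (_+ f) (*-comm (h % n) 2) ⟩
  2 * (h % n) + f              ∎

pack-+1 : ∀ h {f} → f < 2 → pack h f + 1 ≡ pack (h + f) (1 ∸ f)
pack-+1 h {0} _ = lemma h
  where
  lemma : ∀ h → 2 * h + 0 + 1 ≡ 2 * (h + 0) + 1
  lemma = solve-∀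
pack-+1 h {1} _ = lemma h
  where
  lemma : ∀ h → 2 * h + 1 + 1 ≡ 2 * (h + 1) + 0
  lemma = solve-∀
pack-+1 _ {suc (suc _)} (s≤s (s≤s ()))

1∸f<2 : ∀ f → 1 ∸ f < 2
1∸f<2 f = s≤s (m∸n≤m 1 f)

1∸-injective : ∀ {f f′} → f < 2 → f′ < 2 → 1 ∸ f ≡ 1 ∸ f′ → f ≡ f′
1∸-injective (s≤s z≤n) (s≤s z≤n) _ = refl
1∸-injective (s≤s (s≤s z≤n)) (s≤s (s≤s z≤n)) _ = refl
1∸-injective (s≤s z≤n) (s≤s (s≤s z≤n)) ()
1∸-injective (s≤s (s≤s z≤n)) (s≤s z≤n) ()

partner : ℕ → ℕ
partner r with r % 2
... | zero = suc r
... | suc _ = r ∸ 1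

partner-pack : ∀ h {f} → f < 2 → partner (pack h f) ≡ pack h (1 ∸ f)
partner-pack h {0} f<2 rewrite pack-%2 h f<2 = sym (+-suc (2 * h) 0)
partner-pack h {1} f<2 rewrite pack-%2 h f<2 = trans (m+n∸n≡m (2 * h) 1) (sym (+-identityʳ (2 * h)))
partner-pack _ {suc (suc _)} (s≤s (s≤s ()))

!-++ˡ : ∀ (xs : PWord) {ys j} → j < length xs → (xs ++ ys) ! j ≡ xs ! j
!-++ˡ (x ∷ xs) {j = zero} _ = refl
!-++ˡ (x ∷ xs) {j = suc j} (s≤s j<n) = !-++ˡ xs j<n

!-++ʳ : ∀ (xs : PWord) {ys} j → (xs ++ ys) ! (length xs + j) ≡ ys ! j
!-++ʳ [] j = refl
!-++ʳ (x ∷ xs) j = !-++ʳ xs j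

module _ {g : ℕ → PWord} {ℓ : ℕ} (length-g : ∀ i → length (g i) ≡ ℓ) where

  length-concatMap : ∀ h m → length (concatMap g (applyUpTo h m)) ≡ m * ℓ
  length-concatMap h zero = refl
  length-concatMap h (suc m) = begin
    length (g (h 0) ++ concatMap g (applyUpTo (h ∘′ suc) m))
      ≡⟨ length-++ (g (h 0)) ⟩
    length (g (h 0)) + length (concatMap g (applyUpTo (h ∘′ suc) m))
      ≡⟨ cong₂ _+_ (length-g (h 0)) (length-concatMap (h ∘′ suc) m) ⟩
    ℓ + m * ℓ ∎

  concatMap-! : ∀ h m (r : PWord) {k j} → k < m → j < ℓ →
                (concatMap g (applyUpTo h m) ++ r) ! (k * ℓ + j) ≡ g (h k) ! j
  concatMap-! h (suc m) r {zero} {j} _ j<ℓ = begin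
    ((g (h 0) ++ rest) ++ r) ! j   ≡⟨ cong (_! j) (++-assoc (g (h 0)) rest r) ⟩
    (g (h 0) ++ (rest ++ r)) ! j   ≡⟨ !-++ˡ (g (h 0)) (subst (j <_) (sym (length-g (h 0))) j<ℓ) ⟩
    g (h 0) ! j                    ∎
    where rest = concatMap g (applyUpTo (h ∘′ suc) m)
  concatMap-! h (suc m) r {suc k} {j} (s≤s k<m) j<ℓ = begin
    ((g (h 0) ++ rest) ++ r) ! (suc k * ℓ + j)
      ≡⟨ cong₂ _!_ (++-assoc (g (h 0)) rest r) shift ⟩
    (g (h 0) ++ (rest ++ r)) ! (length (g (h 0)) + (k * ℓ + j))
      ≡⟨ !-++ʳ (g (h 0)) (k * ℓ + j) ⟩
    (rest ++ r) ! (k * ℓ + j)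
      ≡⟨ concatMap-! (h ∘′ suc) m r k<m j<ℓ ⟩
    g (h (suc k)) ! j ∎
    where
    rest = concatMap g (applyUpTo (h ∘′ suc) m)
    shift : suc k * ℓ + j ≡ length (g (h 0)) + (k * ℓ + j)
    shift = trans (+-assoc ℓ (k * ℓ) j) (cong (_+ (k * ℓ + j)) (sym (length-g (h 0))))

  concatMap-!-end : ∀ h m (r : PWord) j → (concatMap g (applyUpTo h m) ++ r) ! (m * ℓ + j) ≡ r ! j
  concatMap-!-end h m r j =
    trans (cong (λ l → (concatMap g (applyUpTo h m) ++ r) ! (l + j)) (sym (length-concatMap h m)))
          (!-++ʳ (concatMap g (applyUpTo h m)) j)

record Window (w : PWord) (s : ℕ) (c : Vec ℕ 4) : Set where
  field
    matches : (j : Fin 4) → Compat (w ! (toℕ j + s)) (lookup c j)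
open Window

window : ∀ {w s c₀ c₁ c₂ c₃} → Compat (w ! s) c₀ → Compat (w ! (1 + s)) c₁ →
         Compat (w ! (2 + s)) c₂ → Compat (w ! (3 + s)) c₃ → Window w s (c₀ ∷ c₁ ∷ c₂ ∷ c₃ ∷ [])
matches (window p₀ p₁ p₂ p₃) zero = p₀
matches (window p₀ p₁ p₂ p₃) (suc zero) = p₁
matches (window p₀ p₁ p₂ p₃) (suc (suc zero)) = p₂
matches (window p₀ p₁ p₂ p₃) (suc (suc (suc zero))) = p₃

pack-agree : ∀ {h h′ f f′ c} → f < 2 → f′ < 2 →
             Compat (just (pack h f)) c → Compat (just (pack h′ f′)) c → h ≡ h′ × f ≡ f′
pack-agree f<2 f′<2 c≡ c≡′ = pack-injective f<2 f′<2 (trans (sym c≡) c≡′)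

Compat-map : ∀ (g : ℕ → ℕ) {e c} → Compat e c → Compat (Maybe.map g e) (g c)
Compat-map g {nothing} _ = tt
Compat-map g {just _} refl = refl

!-map : ∀ (g : ℕ → ℕ) (w : PWord) m → List.map (Maybe.map g) w ! m ≡ Maybe.map g (w ! m)
!-map g [] m = refl
!-map g (e ∷ w) zero = refl
!-map g (e ∷ w) (suc m) = !-map g w m

Window-map : ∀ (g : ℕ → ℕ) {w s c} → Window w s c → Window (List.map (Maybe.map g) w) s (Vec.map g c)
matches (Window-map g {w} {s} {c} W) j =
  subst₂ Compat (sym (!-map g w (toℕ j + s))) (sym (lookup-map j g c)) (Compat-map g (matches W j))

-- Parity patterns

blockParity : ℕ → PWord
blockParity f = just f ∷ just f ∷ just (1 ∸ f) ∷ []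

parityStretch : ℕ → PWord
parityStretch f = blockParity f ++ nothing ∷ blockParity (1 ∸ f)

offset : Vec ℕ 4 → ℕ
offset (0 ∷ 0 ∷ 1 ∷ _ ∷ []) = 0
offset (1 ∷ 1 ∷ 0 ∷ _ ∷ []) = 0
offset (0 ∷ 1 ∷ _ ∷ 1 ∷ []) = 1
offset (1 ∷ 0 ∷ _ ∷ 0 ∷ []) = 1
offset (1 ∷ _ ∷ 1 ∷ 1 ∷ []) = 2
offset (0 ∷ _ ∷ 0 ∷ 0 ∷ []) = 2
offset _ = 3

bit-cases : ∀ (P : ℕ → Set) → P 0 → P 1 → ∀ {x} → x < 2 → P x
bit-cases P p₀ p₁ (s≤s z≤n) = p₀
bit-cases P p₀ p₁ (s≤s (s≤s z≤n)) = p₁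

offset-parityStretch : ∀ {s f p} → s < 4 → f < 2 → (∀ j → lookup p j < 2) →
                       Window (parityStretch f) s p → offset p ≡ s
offset-parityStretch {0} {0} {p₀ ∷ p₁ ∷ p₂ ∷ p₃ ∷ []} _ _ _ W
  rewrite matches W zero | matches W (suc zero) | matches W (suc (suc zero)) = refl
offset-parityStretch {0} {1} {p₀ ∷ p₁ ∷ p₂ ∷ p₃ ∷ []} _ _ _ W
  rewrite matches W zero | matches W (suc zero) | matches W (suc (suc zero)) = refl
offset-parityStretch {1} {0} {p₀ ∷ p₁ ∷ p₂ ∷ p₃ ∷ []} _ _ _ W
  rewrite matches W zero | matches W (suc zero) | matches W (suc (suc (suc zero))) = refl
offset-parityStretch {1} {1} {p₀ ∷ p₁ ∷ p₂ ∷ p₃ ∷ []} _ _ _ W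
  rewrite matches W zero | matches W (suc zero) | matches W (suc (suc (suc zero))) = refl
offset-parityStretch {2} {0} {p₀ ∷ p₁ ∷ p₂ ∷ p₃ ∷ []} _ _ bits W
  rewrite matches W zero | matches W (suc (suc zero)) | matches W (suc (suc (suc zero))) =
  bit-cases (λ x → offset (1 ∷ x ∷ 1 ∷ 1 ∷ []) ≡ 2) refl refl (bits (suc zero))
offset-parityStretch {2} {1} {p₀ ∷ p₁ ∷ p₂ ∷ p₃ ∷ []} _ _ bits W
  rewrite matches W zero | matches W (suc (suc zero)) | matches W (suc (suc (suc zero))) =
  bit-cases (λ x → offset (0 ∷ x ∷ 0 ∷ 0 ∷ []) ≡ 2) refl refl (bits (suc zero))
offset-parityStretch {3} {0} {p₀ ∷ p₁ ∷ p₂ ∷ p₃ ∷ []} _ _ bits W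
  rewrite matches W (suc zero) | matches W (suc (suc zero)) | matches W (suc (suc (suc zero))) =
  bit-cases (λ x → offset (x ∷ 1 ∷ 1 ∷ 0 ∷ []) ≡ 3) refl refl (bits zero)
offset-parityStretch {3} {1} {p₀ ∷ p₁ ∷ p₂ ∷ p₃ ∷ []} _ _ bits W
  rewrite matches W (suc zero) | matches W (suc (suc zero)) | matches W (suc (suc (suc zero))) =
  bit-cases (λ x → offset (x ∷ 0 ∷ 0 ∷ 1 ∷ []) ≡ 3) refl refl (bits zero)
offset-parityStretch {suc (suc (suc (suc _)))} (s≤s (s≤s (s≤s (s≤s ()))))
offset-parityStretch {f = suc (suc _)} _ (s≤s (s≤s ()))

-- The construction for a = 2b

module Universality (n : ℕ) (a≥2 : 2 ≤ suc n * 2) where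
  open Construction (suc n * 2) a≥2

  -- b = a / 2, written suc n so that b, b² and b³ are nonzero by computation.
  b b² b³ : ℕ
  b = suc n
  b² = b * b
  b³ = b * b²

  hi mid lo : ℕ → ℕ
  hi t = t / b²
  mid t = t % b² / b
  lo t = t % b

  low : ℕ → ℕ → ℕ
  low p e = e + p * b

  digits : ℕ → ℕ → ℕ → ℕ
  digits q p e = low p e + q * b²

  low-< : ∀ {p e} → p < b → e < b → low p e < b²
  low-< {p} p<b e<b = <-≤-trans (+-monoˡ-< (p * b) e<b) (*-monoˡ-≤ b p<b)

  [r+q*b²]<b³ : ∀ {r q} → r < b² → q < b → r + q * b² < b³
  [r+q*b²]<b³ {q = q} r<b² q<b = <-≤-trans (+-monoˡ-< (q * b²) r<b²) (*-monoˡ-≤ b² q<b)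

  digits-< : ∀ {q p e} → q < b → p < b → e < b → digits q p e < b³
  digits-< q<b p<b e<b = [r+q*b²]<b³ (low-< p<b e<b) q<b

  hi-< : ∀ {t} → t < b³ → hi t < b
  hi-< = m<n*o⇒m/o<n

  mid-< : ∀ t → mid t < b
  mid-< t = m<n*o⇒m/o<n (m%n<n t b²)

  lo-< : ∀ t → lo t < b
  lo-< t = m%n<n t b

  %b²%b≡lo : ∀ t → t % b² % b ≡ lo t
  %b²%b≡lo t = m∣n⇒o%n%m≡o%m b b² t (divides b refl)

  %b²≡low : ∀ t → t % b² ≡ low (mid t) (lo t)
  %b²≡low t = trans (m≡m%n+[m/n]*n (t % b²) b) (cong (_+ mid t * b) (%b²%b≡lo t))

  mid-low : ∀ {t p e} → e < b → t % b² ≡ low p e → mid t ≡ p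
  mid-low {p = p} e<b eq = trans (cong (_/ b) eq) ([r+q*n]/n≡q p e<b)

  lo-low : ∀ {t p e} → e < b → t % b² ≡ low p e → lo t ≡ e
  lo-low {t} {p} e<b eq = trans (sym (%b²%b≡lo t)) (trans (cong (_% b) eq) ([r+q*n]%n≡r p e<b))

  %b²-digits : ∀ {q p e} → p < b → e < b → digits q p e % b² ≡ low p e
  %b²-digits {q} p<b e<b = [r+q*n]%n≡r q (low-< p<b e<b)

  hi-digits : ∀ {q p e} → p < b → e < b → hi (digits q p e) ≡ q
  hi-digits {q} p<b e<b = [r+q*n]/n≡q q (low-< p<b e<b)

  mid-digits : ∀ {q p e} → p < b → e < b → mid (digits q p e) ≡ p
  mid-digits {q} {p} {e} p<b e<b = mid-low {digits q p e} e<b (%b²-digits {q} p<b e<b)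

  lo-digits : ∀ {q p e} → p < b → e < b → lo (digits q p e) ≡ e
  lo-digits {q} {p} {e} p<b e<b = lo-low {digits q p e} {p} e<b (%b²-digits {q} p<b e<b)

  hi-low-injective : ∀ {t t′} → hi t ≡ hi t′ → t % b² ≡ t′ % b² → t ≡ t′
  hi-low-injective {t} {t′} hi≡ low≡ = begin
    t                   ≡⟨ m≡m%n+[m/n]*n t b² ⟩
    t % b² + hi t * b²  ≡⟨ cong₂ (λ r q → r + q * b²) low≡ hi≡ ⟩
    t′ % b² + hi t′ * b² ≡⟨ m≡m%n+[m/n]*n t′ b² ⟨
    t′                  ∎

  mid-lo-injective : ∀ {t t′} → mid t ≡ mid t′ → lo t ≡ lo t′ → t % b² ≡ t′ % b²
  mid-lo-injective {t} {t′} mid≡ lo≡ = trans (%b²≡low t) (trans (cong₂ low mid≡ lo≡) (sym (%b²≡low t′)))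

  digits-injective : ∀ {t t′} → hi t ≡ hi t′ → mid t ≡ mid t′ → lo t ≡ lo t′ → t ≡ t′
  digits-injective {t} {t′} hi≡ mid≡ lo≡ = hi-low-injective hi≡ (mid-lo-injective {t} {t′} mid≡ lo≡)

  low-shift : ∀ t f → (t + f) % b³ % b² ≡ (t % b² + f) % b²
  low-shift t f = %-shift t f (divides b refl)

  lo-shift : ∀ t f → lo ((t + f) % b³) ≡ (lo t + f) % b
  lo-shift t f = %-shift t f (divides b² (*-comm b b²))

  private
    instance
      nonZero-a²/2 : NonZero ((b * 2 * (b * 2)) / 2)
      nonZero-a²/2 = ≥2⇒nz-half a≥2

  a²/2≡b²*2 : (b * 2 * (b * 2)) / 2 ≡ b² * 2
  a²/2≡b²*2 = trans (cong (_/ 2) (lemma b)) (m*n/n≡m (b² * 2) 2)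
    where
    lemma : ∀ b → b * 2 * (b * 2) ≡ b * b * 2 * 2
    lemma = solve-∀

  M≡b³*2 : M ≡ b³ * 2
  M≡b³*2 = trans (cong (_/ 4) (lemma b)) (m*n/n≡m (b³ * 2) 4)
    where
    lemma : ∀ b → b * 2 * (b * 2 * (b * 2 * 1)) ≡ b * (b * b) * 2 * 4
    lemma = solve-∀

  instance
    nonZero-M : NonZero M
    nonZero-M = subst NonZero (sym M≡b³*2) _

  /[a²/2]≡hi : ∀ k → k / ((b * 2 * (b * 2)) / 2) ≡ hi (k / 2)
  /[a²/2]≡hi k = begin
    k / ((b * 2 * (b * 2)) / 2)  ≡⟨ /-congʳ (trans a²/2≡b²*2 (*-comm b² 2)) ⟩
    k / (2 * b²)                 ≡⟨ m/n/o≡m/[n*o] k 2 b² ⟨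
    k / 2 / b²                   ∎

  %[a²/2]/a≡mid : ∀ k → k % ((b * 2 * (b * 2)) / 2) / (b * 2) ≡ mid (k / 2)
  %[a²/2]/a≡mid k = begin
    k % ((b * 2 * (b * 2)) / 2) / (b * 2) ≡⟨ cong (_/ (b * 2)) (%-congʳ a²/2≡b²*2) ⟩
    k % (b² * 2) / (b * 2)              ≡⟨ /-congʳ {m = k % (b² * 2)} (*-comm b 2) ⟩
    k % (b² * 2) / (2 * b)              ≡⟨ m/n/o≡m/[n*o] (k % (b² * 2)) 2 b ⟨
    k % (b² * 2) / 2 / b                ≡⟨ cong (_/ b) (m%[n*o]/o≡m/o%n k b² 2) ⟩
    k / 2 % b² / b                      ∎

  %a≡pack : ∀ k → k % (b * 2) ≡ pack (lo (k / 2)) (k % 2)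
  %a≡pack k = begin
    r                     ≡⟨ pack-/2-%2 r ⟨
    pack (r / 2) (r % 2)
      ≡⟨ cong₂ pack (m%[n*o]/o≡m/o%n k b 2) (m∣n⇒o%n%m≡o%m 2 (b * 2) k (divides b refl)) ⟩
    pack (lo (k / 2)) (k % 2) ∎
    where r = k % (b * 2)

  zₙ≡partner : ∀ k → zₙ k ≡ partner (k % (b * 2))
  zₙ≡partner k with k % (b * 2) % 2
  ... | zero = refl
  ... | suc _ = refl

  xₙ-pack : ∀ t {f} → f < 2 → xₙ (pack t f) ≡ pack (hi t) f
  xₙ-pack t f<2 = cong₂ pack (trans (/[a²/2]≡hi _) (cong hi (pack-/2 t f<2))) (pack-%2 t f<2)

  yₙ-pack : ∀ t {f} → f < 2 → yₙ (pack t f) ≡ pack (mid t) f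
  yₙ-pack t f<2 = cong₂ pack (trans (%[a²/2]/a≡mid _) (cong mid (pack-/2 t f<2))) (pack-%2 t f<2)

  zₙ-pack : ∀ t {f} → f < 2 → zₙ (pack t f) ≡ pack (lo t) (1 ∸ f)
  zₙ-pack t {f} f<2 = begin
    zₙ (pack t f)                              ≡⟨ zₙ≡partner (pack t f) ⟩
    partner (pack t f % (b * 2))               ≡⟨ cong partner (%a≡pack (pack t f)) ⟩
    partner (pack (lo (pack t f / 2)) (pack t f % 2))
      ≡⟨ cong partner (cong₂ pack (cong lo (pack-/2 t f<2)) (pack-%2 t f<2)) ⟩
    partner (pack (lo t) f)                    ≡⟨ partner-pack (lo t) f<2 ⟩
    pack (lo t) (1 ∸ f)                        ∎

  letterBlock : ℕ → ℕ → PWord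
  letterBlock t f = just (pack (hi t) f) ∷ just (pack (mid t) f) ∷ just (pack (lo t) (1 ∸ f)) ∷ []

  wₙ-pack : ∀ t {f} → f < 2 → wₙ (pack t f) ≡ letterBlock t f
  wₙ-pack t f<2 = cong₂ (λ x w → just x ∷ w) (xₙ-pack t f<2)
                    (cong₂ (λ y z → just y ∷ just z ∷ []) (yₙ-pack t f<2) (zₙ-pack t f<2))

  data Index : ℕ → Set where
    index : ∀ {t f} → t < b³ → f < 2 → Index (pack t f)

  index-view : ∀ {k} → k < M → Index k
  index-view {k} k<M =
    subst Index (pack-/2-%2 k) (index (m<n*o⇒m/o<n (subst (k <_) M≡b³*2 k<M)) (m%n<n k 2))

  pack<M : ∀ {t f} → t < b³ → f < 2 → pack t f < M
  pack<M {t} {f} t<b³ f<2 = subst (pack t f <_) (sym M≡b³*2) (pack-< t<b³ f<2)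

  next : ℕ → ℕ
  next k = (k + 1) % M

  next-pack : ∀ t {f} → f < 2 → next (pack t f) ≡ pack ((t + f) % b³) (1 ∸ f)
  next-pack t {f} f<2 = begin
    (pack t f + 1) % M                ≡⟨ cong (_% M) (pack-+1 t f<2) ⟩
    pack (t + f) (1 ∸ f) % M          ≡⟨ %-congʳ M≡b³*2 ⟩
    pack (t + f) (1 ∸ f) % (b³ * 2)   ≡⟨ pack-% (t + f) (1∸f<2 f) ⟩
    pack ((t + f) % b³) (1 ∸ f)       ∎

  next-injective : ∀ {k k′} → k < M → k′ < M → next k ≡ next k′ → k ≡ k′
  next-injective = +-%-injective 1

  next-surjective : ∀ {j} → j < M → ∃[ k ] k < M × next k ≡ j
  next-surjective = +-%-surjective 1

  block : ℕ → PWord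
  block k = wₙ k ++ nothing ∷ []

  stretch : ℕ → PWord
  stretch k = block k ++ wₙ (next k)

  packedStretch : ℕ → ℕ → PWord
  packedStretch t f = letterBlock t f ++ nothing ∷ letterBlock ((t + f) % b³) (1 ∸ f)

  stretch-pack : ∀ t {f} → f < 2 → stretch (pack t f) ≡ packedStretch t f
  stretch-pack t {f} f<2 =
    cong₂ (λ w w′ → w ++ nothing ∷ w′) (wₙ-pack t f<2)
          (trans (cong wₙ (next-pack t f<2)) (wₙ-pack ((t + f) % b³) (1∸f<2 f)))

  length-u : length u ≡ M * 4 + 3
  length-u = trans (length-++ (concatMap block (upTo M)))
                   (cong (_+ 3) (length-concatMap (λ _ → refl) (λ k → k) M))

  u-block : ∀ {k j} → k < M → j < 4 → u ! (k * 4 + j) ≡ block k ! j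
  u-block = concatMap-! (λ _ → refl) (λ k → k) M (wₙ 0)

  k*4+[4+j]≡[1+k]*4+j : ∀ k j → k * 4 + (4 + j) ≡ suc k * 4 + j
  k*4+[4+j]≡[1+k]*4+j = solve-∀

  -- The case split is an argument, not a with: abstracting over a goal that mentions u makes
  -- Agda normalise u.
  u-next-block : ∀ {k j} → suc k < M ⊎ suc k ≡ M → j < 3 → u ! (k * 4 + (4 + j)) ≡ wₙ (next k) ! j
  u-next-block {k} {j} (inj₁ 1+k<M) j<3 = begin
    u ! (k * 4 + (4 + j))  ≡⟨ cong (u !_) (k*4+[4+j]≡[1+k]*4+j k j) ⟩
    u ! (suc k * 4 + j)    ≡⟨ u-block 1+k<M (m<n⇒m<1+n j<3) ⟩
    block (suc k) ! j      ≡⟨ !-++ˡ (wₙ (suc k)) j<3 ⟩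
    wₙ (suc k) ! j         ≡⟨ cong (λ i → wₙ i ! j) next≡suc ⟨
    wₙ (next k) ! j        ∎
    where
    next≡suc : next k ≡ suc k
    next≡suc = trans (cong (_% M) (+-comm k 1)) (m<n⇒m%n≡m 1+k<M)
  u-next-block {k} {j} (inj₂ 1+k≡M) j<3 = begin
    u ! (k * 4 + (4 + j))  ≡⟨ cong (u !_) (trans (k*4+[4+j]≡[1+k]*4+j k j) (cong (λ m → m * 4 + j) 1+k≡M)) ⟩
    u ! (M * 4 + j)        ≡⟨ concatMap-!-end (λ _ → refl) (λ k → k) M (wₙ 0) j ⟩
    wₙ 0 ! j               ≡⟨ cong (λ i → wₙ i ! j) next≡0 ⟨
    wₙ (next k) ! j        ∎
    where
    next≡0 : next k ≡ 0
    next≡0 = trans (cong (_% M) (trans (+-comm k 1) 1+k≡M)) (n%n≡0 M)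

  u-stretch : ∀ {k m} → k < M → m < 7 → u ! (k * 4 + m) ≡ stretch k ! m
  u-stretch {k} {m} k<M m<7 = u-stretch′ (m <? 4)
    where
    u-stretch′ : Dec (m < 4) → u ! (k * 4 + m) ≡ stretch k ! m
    u-stretch′ (yes m<4) = trans (u-block k<M m<4) (sym (!-++ˡ (block k) m<4))
    u-stretch′ (no m≮4) = subst (λ m → u ! (k * 4 + m) ≡ stretch k ! m) (m+[n∸m]≡n 4≤m)
      (trans (u-next-block (m≤n⇒m<n∨m≡n k<M) (∸-monoˡ-< m<7 4≤m))
             (sym (!-++ʳ (block k) {wₙ (next k)} (m ∸ 4))))
      where
      4≤m : 4 ≤ m
      4≤m = ≮⇒≥ m≮4

  WindowCovers : ℕ → ℕ → Vec ℕ 4 → Set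
  WindowCovers k = Window (stretch k)

  u-window : ∀ {k s} → k < M → s < 4 → (j : Fin 4) → u ! (k * 4 + s + toℕ j) ≡ stretch k ! (toℕ j + s)
  u-window {k} {s} k<M s<4 j =
    trans (cong (u !_) (trans (+-assoc (k * 4) s (toℕ j)) (cong (k * 4 +_) (+-comm s (toℕ j)))))
          (u-stretch k<M (s≤s (+-mono-≤ (≤-pred (toℕ<n j)) (≤-pred s<4))))

  window-fits : ∀ {k s} → k < M → s < 4 → k * 4 + s + 4 ≤ length u
  window-fits {k} {s} k<M s<4 =
    ≤-trans (+-monoˡ-≤ 4 (+-monoʳ-≤ (k * 4) (≤-pred s<4)))
            (subst₂ _≤_ (lemma k) (sym length-u) (+-monoˡ-≤ 3 (*-monoˡ-≤ 4 k<M)))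
    where
    lemma : ∀ k → suc k * 4 + 3 ≡ k * 4 + 3 + 4
    lemma = solve-∀

  window⇒covers : ∀ {k s} {x : Vec (Fin (b * 2)) 4} → k < M → s < 4 →
                  WindowCovers k s (Vec.map toℕ x) → Covers u (k * 4 + s) x
  window⇒covers {x = x} k<M s<4 W =
    window-fits k<M s<4 , λ j → subst₂ Compat (sym (u-window k<M s<4 j)) (lookup-map j toℕ x) (matches W j)

  covers⇒window : ∀ {k s} {x : Vec (Fin (b * 2)) 4} → k < M → s < 4 →
                  Covers u (k * 4 + s) x → WindowCovers k s (Vec.map toℕ x)
  matches (covers⇒window {x = x} k<M s<4 (_ , cov)) j =
    subst₂ Compat (u-window k<M s<4 j) (sym (lookup-map j toℕ x)) (cov j)

  i≡[i/4]*4+i%4 : ∀ i → i ≡ i / 4 * 4 + i % 4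
  i≡[i/4]*4+i%4 i = trans (m≡m%n+[m/n]*n i 4) (+-comm (i % 4) (i / 4 * 4))

  fits⇒i/4<M : ∀ {i} → i + 4 ≤ length u → i / 4 < M
  fits⇒i/4<M {i} fits = m<n*o⇒m/o<n (+-cancelʳ-≤ 3 (suc i) (M * 4) (subst₂ _≤_ (lemma i) length-u fits))
    where
    lemma : ∀ i → i + 4 ≡ suc i + 3
    lemma = solve-∀

  letterBlock-parities : ∀ t {f} → f < 2 → List.map (Maybe.map (_% 2)) (letterBlock t f) ≡ blockParity f
  letterBlock-parities t {f} f<2 =
    cong₂ (λ x w → just x ∷ w) (pack-%2 (hi t) f<2)
          (cong₂ (λ y z → just y ∷ just z ∷ []) (pack-%2 (mid t) f<2) (pack-%2 (lo t) (1∸f<2 f)))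

  stretch-parities : ∀ t {f} → f < 2 → List.map (Maybe.map (_% 2)) (stretch (pack t f)) ≡ parityStretch f
  stretch-parities t {f} f<2 = begin
    List.map parity (stretch (pack t f))
      ≡⟨ cong (List.map parity) (stretch-pack t f<2) ⟩
    List.map parity (packedStretch t f)
      ≡⟨ map-++ parity (letterBlock t f) (nothing ∷ letterBlock T (1 ∸ f)) ⟩
    List.map parity (letterBlock t f) ++ nothing ∷ List.map parity (letterBlock T (1 ∸ f))
      ≡⟨ cong₂ (λ w w′ → w ++ nothing ∷ w′)
               (letterBlock-parities t f<2) (letterBlock-parities T (1∸f<2 f)) ⟩
    parityStretch f ∎
    where
    parity : Maybe ℕ → Maybe ℕ
    parity = Maybe.map (_% 2)
    T : ℕ
    T = (t + f) % b³

  window-offset : ∀ {k s c} → Index k → s < 4 → WindowCovers k s c → offset (Vec.map (_% 2) c) ≡ s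
  window-offset {s = s} {c} (index {t} {f} _ f<2) s<4 W =
    offset-parityStretch s<4 f<2 bits
      (subst (λ w → Window w s (Vec.map (_% 2) c)) (stretch-parities t f<2)
             (Window-map (_% 2) {stretch (pack t f)} {s} {c} W))
    where
    bits : ∀ j → lookup (Vec.map (_% 2) c) j < 2
    bits j = subst (_< 2) (sym (lookup-map j (_% 2) c)) (m%n<n (lookup c j) 2)

  pack-from-successor : ∀ {t f t′ f′} → t < b³ → f < 2 → t′ < b³ → f′ < 2 →
                        (t + f) % b³ ≡ (t′ + f′) % b³ → 1 ∸ f ≡ 1 ∸ f′ → pack t f ≡ pack t′ f′
  pack-from-successor {t} {f} {t′} {f′} t<b³ f<2 t′<b³ f′<2 T≡ g≡ =
    next-injective (pack<M t<b³ f<2) (pack<M t′<b³ f′<2)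
      (trans (next-pack t f<2) (trans (cong₂ pack T≡ g≡) (sym (next-pack t′ f′<2))))

  -- Offset 0 reads the digits of t; the other offsets read enough digits of t and of
  -- (t + f) % b³ to determine the index of the next block.
  packedStretch-injective : ∀ {s t f t′ f′ c} → s < 4 → t < b³ → f < 2 → t′ < b³ → f′ < 2 →
    Window (packedStretch t f) s c → Window (packedStretch t′ f′) s c → pack t f ≡ pack t′ f′
  packedStretch-injective {0} {t} {f} {t′} {f′} _ _ f<2 _ f′<2 W W′ =
    cong₂ pack (digits-injective {t} {t′} (proj₁ x≡) (proj₁ y≡) z≡) (proj₂ x≡)
    where
    x≡ : hi t ≡ hi t′ × f ≡ f′
    x≡ = pack-agree f<2 f′<2 (matches W (# 0)) (matches W′ (# 0))
    y≡ : mid t ≡ mid t′ × f ≡ f′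
    y≡ = pack-agree f<2 f′<2 (matches W (# 1)) (matches W′ (# 1))
    z≡ : lo t ≡ lo t′
    z≡ = proj₁ (pack-agree (1∸f<2 f) (1∸f<2 f′) (matches W (# 2)) (matches W′ (# 2)))
  packedStretch-injective {1} {t} {f} {t′} {f′} _ t<b³ f<2 t′<b³ f′<2 W W′ =
    pack-from-successor t<b³ f<2 t′<b³ f′<2 T≡ (cong (1 ∸_) f≡)
    where
    y≡ : mid t ≡ mid t′ × f ≡ f′
    y≡ = pack-agree f<2 f′<2 (matches W (# 0)) (matches W′ (# 0))
    f≡ : f ≡ f′
    f≡ = proj₂ y≡
    z≡ : lo t ≡ lo t′
    z≡ = proj₁ (pack-agree (1∸f<2 f) (1∸f<2 f′) (matches W (# 1)) (matches W′ (# 1)))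
    hiT≡ : hi ((t + f) % b³) ≡ hi ((t′ + f′) % b³)
    hiT≡ = proj₁ (pack-agree (1∸f<2 f) (1∸f<2 f′) (matches W (# 3)) (matches W′ (# 3)))
    T≡ : (t + f) % b³ ≡ (t′ + f′) % b³
    T≡ = hi-low-injective hiT≡ (begin
      (t + f) % b³ % b²      ≡⟨ low-shift t f ⟩
      (t % b² + f) % b²      ≡⟨ cong₂ (λ r g → (r + g) % b²) (mid-lo-injective {t} {t′} (proj₁ y≡) z≡) f≡ ⟩
      (t′ % b² + f′) % b²    ≡⟨ low-shift t′ f′ ⟨
      (t′ + f′) % b³ % b²    ∎)
  packedStretch-injective {2} {t} {f} {t′} {f′} _ t<b³ f<2 t′<b³ f′<2 W W′ =
    pack-from-successor t<b³ f<2 t′<b³ f′<2 T≡ (proj₂ z≡)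
    where
    z≡ : lo t ≡ lo t′ × 1 ∸ f ≡ 1 ∸ f′
    z≡ = pack-agree (1∸f<2 f) (1∸f<2 f′) (matches W (# 0)) (matches W′ (# 0))
    f≡ : f ≡ f′
    f≡ = 1∸-injective f<2 f′<2 (proj₂ z≡)
    hiT≡ : hi ((t + f) % b³) ≡ hi ((t′ + f′) % b³)
    hiT≡ = proj₁ (pack-agree (1∸f<2 f) (1∸f<2 f′) (matches W (# 2)) (matches W′ (# 2)))
    midT≡ : mid ((t + f) % b³) ≡ mid ((t′ + f′) % b³)
    midT≡ = proj₁ (pack-agree (1∸f<2 f) (1∸f<2 f′) (matches W (# 3)) (matches W′ (# 3)))
    loT≡ : lo ((t + f) % b³) ≡ lo ((t′ + f′) % b³)
    loT≡ = begin
      lo ((t + f) % b³)      ≡⟨ lo-shift t f ⟩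
      (lo t + f) % b         ≡⟨ cong₂ (λ l g → (l + g) % b) (proj₁ z≡) f≡ ⟩
      (lo t′ + f′) % b       ≡⟨ lo-shift t′ f′ ⟨
      lo ((t′ + f′) % b³)    ∎
    T≡ : (t + f) % b³ ≡ (t′ + f′) % b³
    T≡ = digits-injective {(t + f) % b³} {(t′ + f′) % b³} hiT≡ midT≡ loT≡
  packedStretch-injective {3} {t} {f} {t′} {f′} _ t<b³ f<2 t′<b³ f′<2 W W′ =
    pack-from-successor t<b³ f<2 t′<b³ f′<2
      (digits-injective {(t + f) % b³} {(t′ + f′) % b³} (proj₁ x≡) y≡ z≡) (proj₂ x≡)
    where
    x≡ : hi ((t + f) % b³) ≡ hi ((t′ + f′) % b³) × 1 ∸ f ≡ 1 ∸ f′
    x≡ = pack-agree (1∸f<2 f) (1∸f<2 f′) (matches W (# 1)) (matches W′ (# 1))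
    y≡ : mid ((t + f) % b³) ≡ mid ((t′ + f′) % b³)
    y≡ = proj₁ (pack-agree (1∸f<2 f) (1∸f<2 f′) (matches W (# 2)) (matches W′ (# 2)))
    z≡ : lo ((t + f) % b³) ≡ lo ((t′ + f′) % b³)
    z≡ = proj₁ (pack-agree (1∸f<2 (1 ∸ f)) (1∸f<2 (1 ∸ f′)) (matches W (# 3)) (matches W′ (# 3)))
  packedStretch-injective {suc (suc (suc (suc _)))} (s≤s (s≤s (s≤s (s≤s ()))))

  window-injective : ∀ {k k′ s c} → Index k → Index k′ → s < 4 →
                     WindowCovers k s c → WindowCovers k′ s c → k ≡ k′
  window-injective {s = s} {c} (index {t} {f} t<b³ f<2) (index {t′} {f′} t′<b³ f′<2) s<4 W W′ =
    packedStretch-injective s<4 t<b³ f<2 t′<b³ f′<2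
      (subst (λ w → Window w s c) (stretch-pack t f<2) W)
      (subst (λ w → Window w s c) (stretch-pack t′ f′<2) W′)

  window-unique : ∀ {k k′ s s′ c} → k < M → k′ < M → s < 4 → s′ < 4 →
                  WindowCovers k s c → WindowCovers k′ s′ c → k ≡ k′ × s ≡ s′
  window-unique {k′ = k′} {s} {s′} {c} k<M k′<M s<4 s′<4 W W′ =
    window-injective (index-view k<M) (index-view k′<M) s<4 W
      (subst (λ s → WindowCovers k′ s c) (sym s≡s′) W′) ,
    s≡s′
    where
    s≡s′ : s ≡ s′
    s≡s′ = trans (sym (window-offset (index-view k<M) s<4 W)) (window-offset (index-view k′<M) s′<4 W′)

  Covered : Vec ℕ 4 → Set
  Covered c = ∃[ k ] ∃[ s ] k < M × s < 4 × WindowCovers k s c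

  covered-by-pack : ∀ {t f s c} → t < b³ → f < 2 → s < 4 → Window (packedStretch t f) s c → Covered c
  covered-by-pack {t} {f} {s} {c} t<b³ f<2 s<4 W =
    pack t f , s , pack<M t<b³ f<2 , s<4 , subst (λ w → Window w s c) (sym (stretch-pack t f<2)) W

  covered₀ : ∀ {q p e f c₃} → q < b → p < b → e < b → f < 2 →
             Covered (pack q f ∷ pack p f ∷ pack e (1 ∸ f) ∷ c₃ ∷ [])
  covered₀ {q} {p} {e} {f} q<b p<b e<b f<2 =
    covered-by-pack (digits-< q<b p<b e<b) f<2 z<s
      (window (cong (λ h → pack h f) (sym (hi-digits {q} p<b e<b)))
              (cong (λ h → pack h f) (sym (mid-digits {q} p<b e<b)))
              (cong (λ h → pack h (1 ∸ f)) (sym (lo-digits {q} p<b e<b)))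
              tt)

  covered₁ : ∀ {h₀ h₁ h₃ f c₂} → h₀ < b → h₁ < b → h₃ < b → f < 2 →
             Covered (pack h₀ f ∷ pack h₁ (1 ∸ f) ∷ c₂ ∷ pack h₃ (1 ∸ f) ∷ [])
  covered₁ {h₀} {h₁} {h₃} {f} {c₂} h₀<b h₁<b h₃<b f<2 =
    from-preimage (+-%-surjective f ([r+q*b²]<b³ r<b² h₃<b))
    where
    r<b² : (low h₀ h₁ + f) % b² < b²
    r<b² = m%n<n (low h₀ h₁ + f) b²
    from-preimage : ∃[ t ] t < b³ × (t + f) % b³ ≡ (low h₀ h₁ + f) % b² + h₃ * b² →
                    Covered (pack h₀ f ∷ pack h₁ (1 ∸ f) ∷ c₂ ∷ pack h₃ (1 ∸ f) ∷ [])
    from-preimage (t , t<b³ , t+f≡T) =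
      covered-by-pack t<b³ f<2 (s<s z<s)
        (window (cong (λ h → pack h f) (sym (mid-low {t} {h₀} h₁<b t%b²≡)))
                (cong (λ h → pack h (1 ∸ f)) (sym (lo-low {t} {h₀} h₁<b t%b²≡)))
                tt
                (cong (λ h → pack h (1 ∸ f)) (sym (trans (cong hi t+f≡T) ([r+q*n]/n≡q h₃ r<b²)))))
      where
      t%b²≡ : t % b² ≡ low h₀ h₁
      t%b²≡ = +-%-injective f (m%n<n t b²) (low-< h₀<b h₁<b) (begin
        (t % b² + f) % b²                        ≡⟨ low-shift t f ⟨
        (t + f) % b³ % b²                        ≡⟨ cong (_% b²) t+f≡T ⟩
        ((low h₀ h₁ + f) % b² + h₃ * b²) % b²    ≡⟨ [r+q*n]%n≡r h₃ r<b² ⟩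
        (low h₀ h₁ + f) % b²                     ∎)

  covered₂ : ∀ {h₀ h₂ h₃ f c₁} → h₀ < b → h₂ < b → h₃ < b → f < 2 →
             Covered (pack h₀ (1 ∸ f) ∷ c₁ ∷ pack h₂ (1 ∸ f) ∷ pack h₃ (1 ∸ f) ∷ [])
  covered₂ {h₀} {h₂} {h₃} {f} {c₁} h₀<b h₂<b h₃<b f<2 =
    from-preimage (+-%-surjective f (digits-< h₂<b h₃<b e<b))
    where
    e<b : (h₀ + f) % b < b
    e<b = m%n<n (h₀ + f) b
    from-preimage : ∃[ t ] t < b³ × (t + f) % b³ ≡ digits h₂ h₃ ((h₀ + f) % b) →
                    Covered (pack h₀ (1 ∸ f) ∷ c₁ ∷ pack h₂ (1 ∸ f) ∷ pack h₃ (1 ∸ f) ∷ [])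
    from-preimage (t , t<b³ , t+f≡T) =
      covered-by-pack t<b³ f<2 (s<s (s<s z<s))
        (window (cong (λ h → pack h (1 ∸ f)) (sym lo-t))
                tt
                (cong (λ h → pack h (1 ∸ f)) (sym (trans (cong hi t+f≡T) (hi-digits {h₂} h₃<b e<b))))
                (cong (λ h → pack h (1 ∸ f)) (sym (trans (cong mid t+f≡T) (mid-digits {h₂} h₃<b e<b)))))
      where
      lo-t : lo t ≡ h₀
      lo-t = +-%-injective f (lo-< t) h₀<b (begin
        (lo t + f) % b                     ≡⟨ lo-shift t f ⟨
        lo ((t + f) % b³)                  ≡⟨ cong lo t+f≡T ⟩
        lo (digits h₂ h₃ ((h₀ + f) % b))   ≡⟨ lo-digits {h₂} h₃<b e<b ⟩
        (h₀ + f) % b                       ∎)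

  covered₃ : ∀ {q p e g c₀} → q < b → p < b → e < b → g < 2 →
             Covered (c₀ ∷ pack q g ∷ pack p g ∷ pack e (1 ∸ g) ∷ [])
  covered₃ {q} {p} {e} {g} {c₀} q<b p<b e<b g<2 =
    from-preimage (next-surjective (pack<M (digits-< q<b p<b e<b) g<2))
    where
    c : Vec ℕ 4
    c = c₀ ∷ pack q g ∷ pack p g ∷ pack e (1 ∸ g) ∷ []
    from-preimage : ∃[ k ] k < M × next k ≡ pack (digits q p e) g → Covered c
    from-preimage (k , k<M , next≡) =
      k , 3 , k<M , s<s (s<s (s<s z<s)) ,
      subst (λ w → Window (block k ++ w) 3 c)
            (sym (trans (cong wₙ next≡) (wₙ-pack (digits q p e) g<2)))
            (window tt
                    (cong (λ h → pack h g) (sym (hi-digits {q} p<b e<b)))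
                    (cong (λ h → pack h g) (sym (mid-digits {q} p<b e<b)))
                    (cong (λ h → pack h (1 ∸ g)) (sym (lo-digits {q} p<b e<b))))

  data Letter : ℕ → Set where
    even : ∀ {h} → h < b → Letter (pack h 0)
    odd  : ∀ {h} → h < b → Letter (pack h 1)

  letter-view : ∀ {c} → c < b * 2 → Letter c
  letter-view {c} c<a with c % 2 | m%n<n c 2 | pack-/2-%2 c
  ... | 0 | _ | c≡ = subst Letter c≡ (even (m<n*o⇒m/o<n c<a))
  ... | 1 | _ | c≡ = subst Letter c≡ (odd (m<n*o⇒m/o<n c<a))
  ... | suc (suc _) | s≤s (s≤s ()) | _

  letters-covered : ∀ {c₀ c₁ c₂ c₃} → Letter c₀ → Letter c₁ → Letter c₂ → Letter c₃ →
                    Covered (c₀ ∷ c₁ ∷ c₂ ∷ c₃ ∷ [])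
  letters-covered (even q)  (even p)  (odd e)   _         = covered₀ q p e z<s
  letters-covered (odd q)   (odd p)   (even e)  _         = covered₀ q p e (s<s z<s)
  letters-covered _         (even q)  (even p)  (odd e)   = covered₃ q p e z<s
  letters-covered _         (odd q)   (odd p)   (even e)  = covered₃ q p e (s<s z<s)
  letters-covered (even h₀) (odd h₁)  _         (odd h₃)  = covered₁ h₀ h₁ h₃ z<s
  letters-covered (odd h₀)  (even h₁) _         (even h₃) = covered₁ h₀ h₁ h₃ (s<s z<s)
  letters-covered (odd h₀)  _         (odd h₂)  (odd h₃)  = covered₂ h₀ h₂ h₃ z<s
  letters-covered (even h₀) _         (even h₂) (even h₃) = covered₂ h₀ h₂ h₃ (s<s z<s)

  wₙ-in-alphabet : ∀ {k} → Index k → All (LetterIn (b * 2)) (wₙ k)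
  wₙ-in-alphabet (index {t} {f} t<b³ f<2) =
    subst (All (LetterIn (b * 2))) (sym (wₙ-pack t f<2))
          (pack-< (hi-< t<b³) f<2 ∷ pack-< (mid-< t) f<2 ∷ pack-< (lo-< t) (1∸f<2 f) ∷ [])

  u-in-alphabet : IsOver (b * 2) u
  u-in-alphabet =
    ++⁺ (concat⁺ (map⁺ (applyUpTo⁺₁ (λ k → k) M (λ k<M → ++⁺ (wₙ-in-alphabet (index-view k<M)) (tt ∷ [])))))
        (wₙ-in-alphabet (index-view (subst (0 <_) (sym M≡b³*2) z<s)))

  unique-covering : (x : Vec (Fin (b * 2)) 4) →
                    ∃[ i ] (Covers u i x × ((i′ : ℕ) → Covers u i′ x → i′ ≡ i))
  unique-covering x@(l₀ ∷ l₁ ∷ l₂ ∷ l₃ ∷ []) =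
    from-window (letters-covered (letter-view (toℕ<n l₀)) (letter-view (toℕ<n l₁))
                                 (letter-view (toℕ<n l₂)) (letter-view (toℕ<n l₃)))
    where
    from-window : Covered (Vec.map toℕ x) → ∃[ i ] (Covers u i x × ((i′ : ℕ) → Covers u i′ x → i′ ≡ i))
    from-window (k , s , k<M , s<4 , W) = k * 4 + s , window⇒covers k<M s<4 W , unique
      where
      unique : (i : ℕ) → Covers u i x → i ≡ k * 4 + s
      unique i cover =
        trans (i≡[i/4]*4+i%4 i) (cong₂ (λ k s → k * 4 + s) (proj₁ same) (proj₂ same))
        where
        i/4<M : i / 4 < M
        i/4<M = fits⇒i/4<M (proj₁ cover)
        same : i / 4 ≡ k × i % 4 ≡ s
        same = window-unique i/4<M k<M (m%n<n i 4) s<4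
                 (covers⇒window i/4<M (m%n<n i 4) (subst (λ i → Covers u i x) (i≡[i/4]*4+i%4 i) cover)) W

  universal : Universal (b * 2) 4 u
  universal = u-in-alphabet , unique-covering

theorem5p2 : (a : ℕ) → (a≥2 : 2 ≤ a) → 2 ∣ a →
    Universal a 4 (Construction.u a a≥2)
theorem5p2 .(0 * 2) () (divides zero refl)
theorem5p2 .(suc n * 2) a≥2 (divides (suc n) refl) = Universality.universal n a≥2
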